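{- For all $\mathfrak{D}_{\mathfrak{A},\mathfrak{B}}\in(\Sigma x\in\mathbb{A})\mathbb{B}(x)$, the normal form of the cut-net $\{\pi_1,\mathfrak{D}_{\mathfrak{A},\mathfrak{B}}\}$ is $\mathfrak{A}$ and the normal form of the cut-net $\{\pi_2,\mathfrak{D}_{\mathfrak{A},\mathfrak{B}}\}$ is $\mathfrak{B}$, i.e., $\pi_1$ and $\pi_2$ represent the projections on the first and second component.
   Context: Let $\mathbb{A}$ be a principal set of designs on base $\vdash\sigma.1.1$ and $(\mathbb{B}(x))_{x\in\mathbb{A}}$ a family of principal sets on base $\vdash\sigma.2.2$. $(\Sigma x\in\mathbb{A})\mathbb{B}(x)=\{\mathfrak{D}_{\mathfrak{A},\mathfrak{B}}\mid\mathfrak{A}\in\mathbb{A},\mathfrak{B}\in\mathbb{B}(\mathfrak{A})\}$, where $\mathfrak{D}_{\mathfrak{A},\mathfrak{B}}=(+,\sigma,\{1,2\})(-,\sigma.1,\{1\})\mathfrak{A}\cup(+,\sigma,\{1,2\})(-,\sigma.2,\{2\})\mathfrak{B}$ (base $\vdash\sigma$). $Id$ denotes the partial identity (copycat) design, a subset of Girard's $\mathfrak{Fax}_{\xi\vdash\xi'}=\{(-,\xi,I)(+,\xi',I)\mathfrak{Fax}_{\xi'.i\vdash\xi.i}\}$. $\pi_1$, on base $\sigma\vdash\alpha$, is $(-,\sigma,\{1,2\})(+,\sigma.1,\{1\})$ followed by $Id$ on $\sigma.1.1\vdash\alpha$; $\pi_2$ is $(-,\sigma,\{1,2\})(+,\sigma.2,\{2\})$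 followed by $Id$ on $\sigma.2.2\vdash\alpha$. The results are understood up to relocation of the base to $\vdash\alpha$. -}

module Defs where

open import Level using (0ℓ)
open import Data.Nat using (ℕ; _<_; _≟_; s≤s; z≤n)
open import Data.List using (List; []; _∷_; _++_; [_]; map; _∷ʳ_)
open import Data.List.Properties using (≡-dec)
open import Data.List.Relation.Unary.AllPairs using (AllPairs; []; _∷_)
open import Data.List.Relation.Unary.All using ([]; _∷_)
open import Data.List.Membership.Propositional using (_∈_; _─_)
open import Data.List.Membership.DecPropositional _≟_ using (_∈?_)
open import Data.Maybe using (Maybe; just; nothing)
open import Data.Product using (Σ; ∃; _×_; _,_; proj₁)
open import Data.Sum using (_⊎_)
open import Data.Bool using (Bool; true; false; if_then_else_)
open import Data.Empty using (⊥)
open import Data.Unit using (⊤)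
open import Relation.Nullary using (¬_; does; Dec)
open import Relation.Binary.PropositionalEquality using (_≡_; _≢_)

-- A locus is a finite sequence of natural numbers; ξ.i is  ξ · i.
Locus : Set
Locus = List ℕ

_·_ : Locus → ℕ → Locus
ξ · i = ξ ++ [ i ]
infixl 20 _·_

_≟L_ : (ξ ζ : Locus) → Dec (ξ ≡ ζ)
_≟L_ = ≡-dec _≟_

-- A ramification is a finite subset of ℕ, represented canonically as a
-- strictly increasing list.
Ram : Set
Ram = Σ (List ℕ) (AllPairs _<_)

_∈R_ : ℕ → Ram → Set
i ∈R I = i ∈ proj₁ I

ram1 : Ram
ram1 = 1 ∷ [] , [] ∷ []

ram2 : Ram
ram2 = 2 ∷ [] , [] ∷ []

ram12 : Ram
ram12 = 1 ∷ 2 ∷ [] , (s≤s (s≤s z≤n) ∷ []) ∷ [] ∷ []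

data Action : Set where
  pos : Locus → Ram → Action
  neg : Locus → Ram → Action
  dai : Action

Chronicle : Set
Chronicle = List Action

-- Convention: we list the
-- chronicles ending with a positive action (proper or †); they determine
-- the design (the other chronicles are their prefixes).  The empty set is
-- the partial design Ω.
Design : Set₁
Design = Chronicle → Set

-- Chronicles on a positive base ⊢ Γ (Γ = available positive loci):
-- positive actions on available loci (each used once), every negative
-- action is on a sublocus ξ.i (i ∈ I) created by the immediately
-- preceding positive action (+, ξ, I), daimon only at the end, and the
-- chronicle ends positively.
data ChronP (Γ : List Locus) : Chronicle → Set where
  c†    : ChronP Γ [ dai ]
  cend  : ∀ {ξ I} → ξ ∈ Γ → ChronP Γ [ pos ξ I ]
  cstep : ∀ {ξ I i J k} (p : ξ ∈ Γ) → i ∈R I →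
          ChronP (map (ξ · i ·_) (proj₁ J) ++ (Γ ─ p)) k →
          ChronP Γ (pos ξ I ∷ neg (ξ · i) J ∷ k)

IsPos : Action → Set
IsPos (pos _ _) = ⊤
IsPos (neg _ _) = ⊥
IsPos dai = ⊤

IsNeg : Action → Set
IsNeg (neg _ _) = ⊤
IsNeg _ = ⊥

locusOf : Action → Maybe Locus
locusOf (pos ξ _) = just ξ
locusOf (neg ξ _) = just ξ
locusOf dai = nothing

DistinctLoci : Chronicle → Chronicle → Set
DistinctLoci d d' = ∀ x y ξ → x ∈ d → y ∈ d' → locusOf x ≡ just ξ → locusOf y ≢ just ξ

Arborescent : Design → Set
Arborescent D = ∀ c a d → IsPos a → D (c ++ a ∷ d) → D (c ∷ʳ a)

Coherent : Design → Set
Coherent D = ∀ c a a' d d' → D (c ++ a ∷ d) → D (c ++ a' ∷ d') → a ≢ a' →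
  IsNeg a × IsNeg a' × (locusOf a ≢ locusOf a' → DistinctLoci d d')

DesignOn : Locus → Design → Set
DesignOn ξ D = (∀ k → D k → ChronP [ ξ ] k) × Arborescent D × Coherent D

-- Relocation (delocation) of a design: replace the prefix `from` by `to`.

relocL : Locus → Locus → Locus → Locus
relocL [] to l = to ++ l
relocL (x ∷ from) to [] = []
relocL (x ∷ from) to (y ∷ l) =
  if does (x ≟ y) then relocL (from) to l else (y ∷ l)

relocA : Locus → Locus → Action → Action
relocA from to (pos ξ I) = pos (relocL from to ξ) I
relocA from to (neg ξ I) = neg (relocL from to ξ) I
relocA from to dai = dai

Reloc : Locus → Locus → Design → Design
Reloc from to A k = ∃ λ c → A c × k ≡ map (relocA from to) c

-- Fax_{ξ ⊢ ξ'} = {(-,ξ,I)(+,ξ',I) Fax_{ξ'.i ⊢ ξ.i}}   (negative base ξ ⊢ ξ')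

Fax : Locus → Locus → Design
Fax ξ ξ' (neg ζ I ∷ pos ζ' I' ∷ []) = ζ ≡ ξ × ζ' ≡ ξ' × I' ≡ I
Fax ξ ξ' (neg ζ I ∷ pos ζ' I' ∷ neg η J ∷ k) =
  ζ ≡ ξ × ζ' ≡ ξ' × I' ≡ I ×
  (∃ λ i → i ∈R I × η ≡ ξ' · i × Fax (ξ' · i) (ξ · i) (neg η J ∷ k))
Fax ξ ξ' _ = ⊥

-- D_{A,B} = (+,σ,{1,2})(-,σ.1,{1})A ∪ (+,σ,{1,2})(-,σ.2,{2})B   (base ⊢ σ)
Dpair : Locus → Design → Design → Design
Dpair σ A B k =
  k ≡ [ pos σ ram12 ] ⊎
  (∃ λ c → A c × k ≡ pos σ ram12 ∷ neg (σ · 1) ram1 ∷ c) ⊎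
  (∃ λ c → B c × k ≡ pos σ ram12 ∷ neg (σ · 2) ram2 ∷ c)

-- π₁ (base σ ⊢ α): (-,σ,{1,2})(+,σ.1,{1}) followed by Id = Fax on σ.1.1 ⊢ α
π₁ : Locus → Locus → Design
π₁ σ α k =
  k ≡ neg σ ram12 ∷ pos (σ · 1) ram1 ∷ [] ⊎
  (∃ λ c → Fax (σ · 1 · 1) α c × k ≡ neg σ ram12 ∷ pos (σ · 1) ram1 ∷ c)

-- π₂ (base σ ⊢ α): (-,σ,{1,2})(+,σ.2,{2}) followed by Id = Fax on σ.2.2 ⊢ α
π₂ : Locus → Locus → Design
π₂ σ α k =
  k ≡ neg σ ram12 ∷ pos (σ · 2) ram2 ∷ [] ⊎
  (∃ λ c → Fax (σ · 2 · 2) α c × k ≡ neg σ ram12 ∷ pos (σ · 2) ram2 ∷ c)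

-- Normalisation of a cut-net with positive base (abstract machine on
-- chronicles).  A position is a design together with the chronicle
-- played in it so far.  A configuration is the current positive
-- ("head") position plus an environment giving, for each cut locus, the
-- negative position waiting on it.

Env : Set₁
Env = Locus → Maybe (Design × Chronicle)

child? : Locus → Locus → Maybe ℕ
child? [] (i ∷ []) = just i
child? [] _ = nothing
child? (x ∷ ξ) [] = nothing
child? (x ∷ ξ) (y ∷ l) = if does (x ≟ y) then child? ξ l else nothing

-- after the head (D at c) plays the cut action (+,ξ,I): ξ is consumed and
-- every ξ.i (i ∈ I) becomes a cut locus waiting on D at c(+,ξ,I).
update : Env → Locus → Ram → Design → Chronicle → Env
update env ξ I D c l with does (l ≟L ξ) | child? ξ l
... | true  | _ = nothing
... | false | nothing = env l
... | false | just i = if does (i ∈? proj₁ I) then just (D , c) else env l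

data Hnf : Set₁ where
  hdai : Hnf
  -- visible action (+,ξ,I) played by design D at chronicle c, environment
  hvis : Locus → Ram → Design → Chronicle → Env → Hnf

-- finite internal reduction of (head D at c, env) to a head normal form
data Eval (env : Env) (D : Design) (c : Chronicle) : Hnf → Set₁ where
  ev† : D (c ∷ʳ dai) → Eval env D c hdai
  evVis : ∀ {ξ I} → D (c ∷ʳ pos ξ I) → env ξ ≡ nothing →
          Eval env D c (hvis ξ I D c env)
  evCut : ∀ {ξ I E e h} → D (c ∷ʳ pos ξ I) → env ξ ≡ just (E , e) →
          Eval (update env ξ I D (c ∷ʳ pos ξ I)) E (e ∷ʳ neg ξ I) h →
          Eval env D c h

-- the chronicles (ending positively) of the normal form
data Out (env : Env) (D : Design) (c : Chronicle) : Chronicle → Set₁ where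
  o† : Eval env D c hdai → Out env D c [ dai ]
  oVis : ∀ {ξ I D' c' env'} → Eval env D c (hvis ξ I D' c' env') →
         Out env D c [ pos ξ I ]
  oStep : ∀ {ξ I D' c' env' i J k} → Eval env D c (hvis ξ I D' c' env') →
          i ∈R I →
          Out env' D' (c' ∷ʳ pos ξ I ∷ʳ neg (ξ · i) J) k →
          Out env D c (pos ξ I ∷ neg (ξ · i) J ∷ k)

-- Normal form [[{E, D}]] of the cut-net made of D on base ⊢ σ and E on a
-- base σ ⊢ Λ, cut on σ.
cutEnv : Locus → Design → Env
cutEnv σ E l = if does (l ≟L σ) then just (E , []) else nothing

NormalForm : Locus → Design → Design → Chronicle → Set₁
NormalForm σ E D = Out (cutEnv σ E) D []

_≐_ : (Chronicle → Set₁) → Design → Set₁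
N ≐ A = ∀ k → (N k → A k) × (A k → N k)

_⊑_ : Locus → Locus → Set
ξ ⊑ ζ = ∃ λ ρ → ξ ++ ρ ≡ ζ

Disjoint : Locus → Locus → Set
Disjoint ξ ζ = ¬ (ξ ⊑ ζ) × ¬ (ζ ⊑ ξ)

module Submission where

-- Normalising {π_n, D_{A,B}} (n = 1, 2) is a dialogue between the pair D
-- and the projection π_n.  After two opening cuts (D plays (+,σ,{1,2}),
-- π_n answers with (+,σ.n,{n}), D enters its n-th component X = A or B),
-- the head is X and π_n has become the copycat Fax on σ.n.n ⊢ α.  From
-- then on every positive action (+,ξ,I) of X on a locus ξ = σ.n.n.w is cut
-- against the copycat, which immediately replays it as the visible action
-- (+,α.w,I); the opponent's answer (-,α.w.i,J) is copied back to X as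
-- (-,ξ.i,J).  Hence the visible chronicles are exactly the chronicles of X
-- relocated from σ.n.n to α.

open import Defs
open import Data.Nat using (ℕ; zero; suc; _<_; _≟_; _≡ᵇ_)
open import Data.Nat.Properties using (<⇒≢; ≡ᵇ⇒≡)
open import Data.Bool using (T; true)
open import Data.Unit using (tt)
open import Data.List using (List; []; _∷_; _++_; [_]; map; _∷ʳ_)
open import Data.List.Properties
  using (++-assoc; ++-identityʳ; ++-cancelˡ; ∷-injective; ∷-injectiveˡ; ∷-injectiveʳ; ∷ʳ-injectiveʳ; ∷ʳ-++)
open import Data.List.Relation.Unary.Any using (here; there)
open import Data.List.Relation.Unary.All as All using (All; []; _∷_)
open import Data.List.Relation.Unary.AllPairs using (AllPairs; []; _∷_)
open import Data.List.Relation.Unary.AllPairs.Properties using (++⁺)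
open import Data.List.Membership.Propositional using (_∈_; _─_)
open import Data.List.Membership.Propositional.Properties using (∈-map⁻; ∈-++⁻)
open import Data.List.Membership.DecPropositional _≟_ using (_∈?_)
open import Data.Maybe using (just; nothing)
open import Data.Product using (Σ; ∃; _×_; _,_; proj₁; proj₂)
open import Data.Sum using (_⊎_; inj₁; inj₂; [_,_]′)
open import Data.Empty using (⊥-elim)
open import Relation.Nullary using (¬_; yes; no)
open import Relation.Binary.PropositionalEquality
  using (_≡_; _≢_; refl; sym; trans; cong; cong₂; subst; module ≡-Reasoning)

⊑-refl : ∀ ξ → ξ ⊑ ξ
⊑-refl ξ = [] , ++-identityʳ ξ

⊑-trans : ∀ {ξ ζ η} → ξ ⊑ ζ → ζ ⊑ η → ξ ⊑ η
⊑-trans {ξ} (ρ , refl) (ρ' , refl) = ρ ++ ρ' , sym (++-assoc ξ ρ ρ')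

⊑-child : ∀ ξ i → ξ ⊑ (ξ · i)
⊑-child ξ i = [ i ] , refl

⊑-comparable : ∀ ξ ζ {η} → ξ ⊑ η → ζ ⊑ η → ξ ⊑ ζ ⊎ ζ ⊑ ξ
⊑-comparable [] ζ _ _ = inj₁ (ζ , refl)
⊑-comparable (a ∷ ξ) [] _ _ = inj₂ (a ∷ ξ , refl)
⊑-comparable (a ∷ ξ) (b ∷ ζ) (ρ , e) (ρ' , e') with ∷-injective (trans e (sym e'))
... | refl , tail≡ with ⊑-comparable ξ ζ (ρ , tail≡) (ρ' , refl)
...   | inj₁ (r , p) = inj₁ (r , cong (a ∷_) p)
...   | inj₂ (r , p) = inj₂ (r , cong (a ∷_) p)

child-injective : ∀ ξ {i j} → (ξ · i) ⊑ (ξ · j) → i ≡ j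
child-injective ξ {i} {j} (ρ , e) =
  ∷-injectiveˡ (++-cancelˡ ξ (i ∷ ρ) [ j ] (trans (sym (++-assoc ξ [ i ] ρ)) e))

child≢self : ∀ ξ i → ξ · i ≢ ξ
child≢self (x ∷ ξ) i e = child≢self ξ i (∷-injectiveʳ e)

Disjoint-sym : ∀ {ξ ζ} → Disjoint ξ ζ → Disjoint ζ ξ
Disjoint-sym (p , q) = q , p

Disjoint-extend : ∀ {ξ η ζ} → ξ ⊑ η → Disjoint ζ ξ → Disjoint η ζ
Disjoint-extend {ξ} {η} {ζ} ξ⊑η (ζ⋢ξ , ξ⋢ζ) =
  (λ η⊑ζ → ξ⋢ζ (⊑-trans ξ⊑η η⊑ζ)) ,
  (λ ζ⊑η → [ ζ⋢ξ , ξ⋢ζ ]′ (⊑-comparable ζ ξ ζ⊑η ξ⊑η))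

siblings-disjoint : ∀ ξ {i j} → i < j → Disjoint (ξ · i) (ξ · j)
siblings-disjoint ξ i<j =
  (λ p → <⇒≢ i<j (child-injective ξ p)) , (λ p → <⇒≢ i<j (sym (child-injective ξ p)))

-- Comparison of naturals inside the machine's definitions reduces to _≡ᵇ_.
≡ᵇ-refl : ∀ x → (x ≡ᵇ x) ≡ true
≡ᵇ-refl zero = refl
≡ᵇ-refl (suc x) = ≡ᵇ-refl x

relocL-++ : ∀ from to w → relocL from to (from ++ w) ≡ to ++ w
relocL-++ [] to w = refl
relocL-++ (x ∷ from) to w rewrite ≡ᵇ-refl x = relocL-++ from to w

child?-sound : ∀ ξ l {i} → child? ξ l ≡ just i → l ≡ ξ · i
child?-sound [] (x ∷ []) refl = refl
child?-sound [] (x ∷ y ∷ l) ()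
child?-sound (x ∷ ξ) (y ∷ l) e with x ≡ᵇ y in x≡ᵇy
... | true rewrite ≡ᵇ⇒≡ x y (subst T (sym x≡ᵇy) tt) = cong (y ∷_) (child?-sound ξ l e)

child?-complete : ∀ ξ i → child? ξ (ξ · i) ≡ just i
child?-complete [] i = refl
child?-complete (x ∷ ξ) i rewrite ≡ᵇ-refl x = child?-complete ξ i

update-outside : ∀ env ξ I E c l → ¬ (ξ ⊑ l) → update env ξ I E c l ≡ env l
update-outside env ξ I E c l ξ⋢l with l ≟L ξ | child? ξ l in eq
... | yes refl | _ = ⊥-elim (ξ⋢l (⊑-refl l))
... | no _ | nothing = refl
... | no _ | just i = ⊥-elim (ξ⋢l (subst (ξ ⊑_) (sym (child?-sound ξ l eq)) (⊑-child ξ i)))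

update-child : ∀ env ξ I E c i → i ∈R I → update env ξ I E c (ξ · i) ≡ just (E , c)
update-child env ξ I E c i i∈I with (ξ · i) ≟L ξ | child? ξ (ξ · i) | child?-complete ξ i
... | yes e | _ | _ = ⊥-elim (child≢self ξ i e)
... | no _ | .(just i) | refl with i ∈? proj₁ I
...   | yes _ = refl
...   | no i∉I = ⊥-elim (i∉I i∈I)

cutEnv-self : ∀ σ E → cutEnv σ E σ ≡ just (E , [])
cutEnv-self σ E with σ ≟L σ
... | yes _ = refl
... | no σ≢σ = ⊥-elim (σ≢σ refl)

cutEnv-outside : ∀ σ E l → ¬ (σ ⊑ l) → cutEnv σ E l ≡ nothing
cutEnv-outside σ E l σ⋢l with l ≟L σ
... | yes refl = ⊥-elim (σ⋢l (⊑-refl l))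
... | no _ = refl

nothing≢just : ∀ {A : Set₁} {a : A} → nothing ≢ just a
nothing≢just ()

∷ʳ≢[] : ∀ (k : Chronicle) a → k ∷ʳ a ≢ []
∷ʳ≢[] [] a ()
∷ʳ≢[] (_ ∷ _) a ()

∷ʳ-∷ʳ-++ : ∀ (k : Chronicle) a b r → k ∷ʳ a ∷ʳ b ++ r ≡ k ++ a ∷ b ∷ r
∷ʳ-∷ʳ-++ k a b r = begin
  k ∷ʳ a ∷ʳ b ++ r  ≡⟨ ∷ʳ-++ (k ∷ʳ a) b r ⟩
  k ∷ʳ a ++ b ∷ r   ≡⟨ ∷ʳ-++ k a (b ∷ r) ⟩
  k ++ a ∷ b ∷ r    ∎
  where open ≡-Reasoning

chronP-end : ∀ {Γ ξ K} → ChronP Γ [ pos ξ K ] → ξ ∈ Γ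
chronP-end (cend p) = p

chronP-step : ∀ {Γ ξ K η J k} → ChronP Γ (pos ξ K ∷ neg η J ∷ k) →
  Σ (ξ ∈ Γ) λ p → Σ ℕ λ i → i ∈R K × η ≡ ξ · i ×
    ChronP (map (ξ · i ·_) (proj₁ J) ++ (Γ ─ p)) k
chronP-step (cstep p i∈K k) = p , _ , i∈K , refl , k

PairwiseDisjoint : List Locus → Set
PairwiseDisjoint = AllPairs Disjoint

─-⊆ : ∀ {A : Set} {Γ : List A} {ξ ζ} (p : ξ ∈ Γ) → ζ ∈ Γ ─ p → ζ ∈ Γ
─-⊆ (here _) m = there m
─-⊆ (there p) (here e) = here e
─-⊆ (there p) (there m) = there (─-⊆ p m)

─-disjoint : ∀ {Γ ξ ζ} → PairwiseDisjoint Γ → (p : ξ ∈ Γ) → ζ ∈ Γ ─ p → Disjoint ζ ξ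
─-disjoint (ξ# ∷ _) (here refl) m = Disjoint-sym (All.lookup ξ# m)
─-disjoint (ζ# ∷ _) (there p) (here refl) = All.lookup ζ# p
─-disjoint (_ ∷ Γ#) (there p) (there m) = ─-disjoint Γ# p m

─-pairwiseDisjoint : ∀ {Γ ξ} → PairwiseDisjoint Γ → (p : ξ ∈ Γ) → PairwiseDisjoint (Γ ─ p)
─-pairwiseDisjoint (_ ∷ Γ#) (here _) = Γ#
─-pairwiseDisjoint (ζ# ∷ Γ#) (there p) =
  All.tabulate (λ m → All.lookup ζ# (─-⊆ p m)) ∷ ─-pairwiseDisjoint Γ# p

children-pairwiseDisjoint : ∀ ξ {is} → AllPairs _<_ is → PairwiseDisjoint (map (ξ ·_) is)
children-pairwiseDisjoint ξ [] = []
children-pairwiseDisjoint ξ (i<is ∷ is<) =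
  siblings ξ i<is ∷ children-pairwiseDisjoint ξ is<
  where
  siblings : ∀ ξ {i js} → All (i <_) js → All (Disjoint (ξ · i)) (map (ξ ·_) js)
  siblings ξ [] = []
  siblings ξ (i<j ∷ i<js) = siblings-disjoint ξ i<j ∷ siblings ξ i<js

step-pairwiseDisjoint : ∀ {Γ ξ} i (J : Ram) → PairwiseDisjoint Γ → (p : ξ ∈ Γ) →
  PairwiseDisjoint (map (ξ · i ·_) (proj₁ J) ++ (Γ ─ p))
step-pairwiseDisjoint {Γ} {ξ} i J Γ# p =
  ++⁺ (children-pairwiseDisjoint (ξ · i) (proj₂ J)) (─-pairwiseDisjoint Γ# p)
    (All.tabulate λ m → All.tabulate λ m' → new-vs-old m m')
  where
  new-vs-old : ∀ {η ζ} → η ∈ map (ξ · i ·_) (proj₁ J) → ζ ∈ Γ ─ p → Disjoint η ζ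
  new-vs-old m m' with ∈-map⁻ (ξ · i ·_) m
  ... | j , _ , refl =
    Disjoint-extend (⊑-trans (⊑-child ξ i) (⊑-child (ξ · i) j)) (─-disjoint Γ# p m')

-- Copycat paths.  FaxPath ξ ξ' g ζ ζ' : the chronicle g of Fax ξ ξ' is a
-- sequence of completed copycat exchanges after which Fax waits for an
-- action on ζ, to be copied onto ζ'.

data FaxPath : Locus → Locus → Chronicle → Locus → Locus → Set where
  waiting  : ∀ {ξ ξ'} → FaxPath ξ ξ' [] ξ ξ'
  exchange : ∀ {ξ ξ' I i g ζ ζ'} → i ∈R I → FaxPath (ξ' · i) (ξ · i) g ζ ζ' →
             FaxPath ξ ξ' (neg ξ I ∷ pos ξ' I ∷ g) ζ ζ'

fax-unfold : ∀ {ξ ξ' I i J k} → Fax ξ ξ' (neg ξ I ∷ pos ξ' I ∷ neg (ξ' · i) J ∷ k) →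
  Fax (ξ' · i) (ξ · i) (neg (ξ' · i) J ∷ k)
fax-unfold {ξ' = ξ'} (_ , _ , _ , _ , _ , η≡ , f) with ∷ʳ-injectiveʳ ξ' ξ' η≡
... | refl = f

fax-fold : ∀ {ξ ξ' I i J k} → i ∈R I → Fax (ξ' · i) (ξ · i) (neg (ξ' · i) J ∷ k) →
  Fax ξ ξ' (neg ξ I ∷ pos ξ' I ∷ neg (ξ' · i) J ∷ k)
fax-fold {i = i} i∈I f = refl , refl , refl , i , i∈I , refl , f

-- The same, when the exchange is followed by a copycat path; splitting on
-- the path exposes the negative action on ξ'.i that makes Fax unfold.
fax-unfold-path : ∀ {ξ ξ' I i g ζ ζ' J k} → FaxPath (ξ' · i) (ξ · i) g ζ ζ' →
  Fax ξ ξ' (neg ξ I ∷ pos ξ' I ∷ g ++ neg ζ J ∷ k) → Fax (ξ' · i) (ξ · i) (g ++ neg ζ J ∷ k)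
fax-unfold-path waiting f = fax-unfold f
fax-unfold-path (exchange _ _) f = fax-unfold f

fax-fold-path : ∀ {ξ ξ' I i g ζ ζ' J k} → i ∈R I → FaxPath (ξ' · i) (ξ · i) g ζ ζ' →
  Fax (ξ' · i) (ξ · i) (g ++ neg ζ J ∷ k) → Fax ξ ξ' (neg ξ I ∷ pos ξ' I ∷ g ++ neg ζ J ∷ k)
fax-fold-path i∈I waiting f = fax-fold i∈I f
fax-fold-path i∈I (exchange _ _) f = fax-fold i∈I f

fax-descend : ∀ {ξ ξ' g ζ ζ' J k} → FaxPath ξ ξ' g ζ ζ' →
  Fax ξ ξ' (g ++ neg ζ J ∷ k) → Fax ζ ζ' (neg ζ J ∷ k)
fax-descend waiting f = f
fax-descend (exchange _ path) f = fax-descend path (fax-unfold-path path f)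

fax-ascend : ∀ {ξ ξ' g ζ ζ' J k} → FaxPath ξ ξ' g ζ ζ' →
  Fax ζ ζ' (neg ζ J ∷ k) → Fax ξ ξ' (g ++ neg ζ J ∷ k)
fax-ascend waiting f = f
fax-ascend (exchange i∈I path) f = fax-fold-path i∈I path (fax-ascend path f)

fax-answer : ∀ {ζ ζ' K a} → Fax ζ ζ' (neg ζ K ∷ a ∷ []) → a ≡ pos ζ' K
fax-answer {a = pos _ _} (_ , ζ'≡ , K≡) = cong₂ pos ζ'≡ K≡

fax-answered : ∀ {ζ ζ' K} → Fax ζ ζ' (neg ζ K ∷ pos ζ' K ∷ [])
fax-answered = refl , refl , refl

FaxPath-extend : ∀ {ξ ξ' g ζ ζ' K i} → FaxPath ξ ξ' g ζ ζ' → i ∈R K →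
  FaxPath ξ ξ' (g ∷ʳ neg ζ K ∷ʳ pos ζ' K) (ζ' · i) (ζ · i)
FaxPath-extend waiting i∈K = exchange i∈K waiting
FaxPath-extend (exchange i∈I path) i∈K = exchange i∈I (FaxPath-extend path i∈K)

-- The projection π_n on base σ ⊢ α: (-,σ,{1,2})(+,σ.n,r) followed by the
-- copycat on σ.n.n ⊢ α.  Both π₁ and π₂ are, definitionally, instances.
Projection : Locus → Locus → ℕ → Ram → Design
Projection σ α n r k =
  k ≡ neg σ ram12 ∷ pos (σ · n) r ∷ [] ⊎
  (∃ λ c → Fax (σ · n · n) α c × k ≡ neg σ ram12 ∷ pos (σ · n) r ∷ c)

module ProjectionNormalForm
  (σ α : Locus) (σ#α : Disjoint σ α) (n : ℕ) (r : Ram) (n∈r : n ∈R r) (n∈12 : n ∈R ram12)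
  (D X : Design)
  (D-opening : ∀ a → D [ a ] → a ≡ pos σ ram12)
  (D-opens : D [ pos σ ram12 ])
  (D→X : ∀ c → D (pos σ ram12 ∷ neg (σ · n) r ∷ c) → X c)
  (X→D : ∀ c → X c → D (pos σ ram12 ∷ neg (σ · n) r ∷ c))
  (X-chron : ∀ c → X c → ChronP [ σ · n · n ] c)
  (X-arborescent : Arborescent X)
  where

  Π : Design
  Π = Projection σ α n r

  τ : Locus
  τ = σ · n · n

  -- chronicles of Π and of D after the two opening cuts
  Q : Chronicle → Chronicle
  Q g = neg σ ram12 ∷ pos (σ · n) r ∷ g

  P : Chronicle → Chronicle
  P b = pos σ ram12 ∷ neg (σ · n) r ∷ b

  relocate : Action → Action
  relocate = relocA τ α

  data Mirror : Locus → Locus → Set where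
    base  : Mirror τ α
    child : ∀ {ζ ζ'} i → Mirror ζ ζ' → Mirror (ζ · i) (ζ' · i)

  mirror-suffix : ∀ {ζ ζ'} → Mirror ζ ζ' → Σ Locus λ w → ζ ≡ τ ++ w × ζ' ≡ α ++ w
  mirror-suffix base = [] , sym (++-identityʳ τ) , sym (++-identityʳ α)
  mirror-suffix (child i m) with mirror-suffix m
  ... | w , refl , refl = w ++ [ i ] , ++-assoc τ w [ i ] , ++-assoc α w [ i ]

  mirror-relocates : ∀ {ζ ζ'} → Mirror ζ ζ' → relocL τ α ζ ≡ ζ'
  mirror-relocates m with mirror-suffix m
  ... | w , refl , refl = relocL-++ τ α w

  mirror-σ : ∀ {ζ ζ'} → Mirror ζ ζ' → σ ⊑ ζ
  mirror-σ m with mirror-suffix m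
  ... | w , refl , refl = ⊑-trans (⊑-trans (⊑-child σ n) (⊑-child (σ · n) n)) (w , refl)

  mirror-α : ∀ {ζ ζ'} → Mirror ζ ζ' → α ⊑ ζ'
  mirror-α m with mirror-suffix m
  ... | w , refl , refl = w , refl

  -- Nothing below σ is below α, so the cuts never reach the visible loci.
  below-σ-not-α : ∀ {ξ l} → σ ⊑ ξ → α ⊑ l → ¬ (ξ ⊑ l)
  below-σ-not-α σ⊑ξ α⊑l ξ⊑l with ⊑-comparable σ α (⊑-trans σ⊑ξ ξ⊑l) α⊑l
  ... | inj₁ σ⊑α = proj₁ σ#α σ⊑α
  ... | inj₂ α⊑σ = proj₂ σ#α α⊑σ

  copycat-answer : ∀ {g ζ ζ' K a} → FaxPath τ α g ζ ζ' → Π (Q (g ∷ʳ neg ζ K ∷ʳ a)) → a ≡ pos ζ' K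
  copycat-answer {g} path (inj₁ e) = ⊥-elim (∷ʳ≢[] _ _ (∷-injectiveʳ (∷-injectiveʳ e)))
  copycat-answer {g} path (inj₂ (c , f , e))
    rewrite sym (∷-injectiveʳ (∷-injectiveʳ e)) =
    fax-answer (fax-descend path (subst (Fax τ α) (∷ʳ-++ g _ _) f))

  copycat-answered : ∀ {g ζ ζ' K} → FaxPath τ α g ζ ζ' → Π (Q (g ∷ʳ neg ζ K ∷ʳ pos ζ' K))
  copycat-answered {g} path =
    inj₂ (_ , subst (Fax τ α) (sym (∷ʳ-++ g _ _)) (fax-ascend path fax-answered) , refl)

  -- Configuration invariants: no visible locus is a cut, and every locus of
  -- the head's current base is cut against a copycat state of Π.
  NoVisibleCut : Env → Set₁
  NoVisibleCut env = ∀ l → α ⊑ l → env l ≡ nothing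

  no-visible-cut-update : ∀ {env ξ} I E c → σ ⊑ ξ → NoVisibleCut env → NoVisibleCut (update env ξ I E c)
  no-visible-cut-update {env} {ξ} I E c σ⊑ξ nvc l α⊑l =
    trans (update-outside env ξ I E c l (below-σ-not-α σ⊑ξ α⊑l)) (nvc l α⊑l)

  CopycatOn : Env → Locus → Set₁
  CopycatOn env ζ = Σ Locus λ ζ' → Σ Chronicle λ g →
    Mirror ζ ζ' × FaxPath τ α g ζ ζ' × env ζ ≡ just (Π , Q g)

  CopycatEnv : Env → List Locus → Set₁
  CopycatEnv env Γ = ∀ {ζ} → ζ ∈ Γ → CopycatOn env ζ

  -- environments after D plays (+,ξ,K), then after Π replays (-,ξ.i,J)
  env₁ : Env → Chronicle → Locus → Ram → Env
  env₁ env b ξ K = update env ξ K D (P b ∷ʳ pos ξ K)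

  env₂ : Env → Chronicle → Chronicle → Locus → Ram → Locus → ℕ → Ram → Env
  env₂ env b g ξ K ξ' i J =
    update (env₁ env b ξ K) (ξ · i) J Π (Q (g ∷ʳ neg ξ K ∷ʳ pos ξ' K ∷ʳ neg (ξ' · i) J) ∷ʳ pos (ξ · i) J)

  copycatEnv-step : ∀ {env Γ ξ ξ' g K i} b J → CopycatEnv env Γ → PairwiseDisjoint Γ →
    (p : ξ ∈ Γ) → Mirror ξ ξ' → FaxPath τ α g ξ ξ' → i ∈R K →
    CopycatEnv (env₂ env b g ξ K ξ' i J) (map (ξ · i ·_) (proj₁ J) ++ (Γ ─ p))
  copycatEnv-step {env} {Γ} {ξ} {ξ'} {g} {K} {i} b J cc Γ# p m path i∈K {ζ} ζ∈
    with ∈-++⁻ (map (ξ · i ·_) (proj₁ J)) ζ∈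
  ... | inj₁ new with ∈-map⁻ (ξ · i ·_) new
  ...   | j , j∈J , refl =
    ξ' · i · j , _ , child j (child i m) , FaxPath-extend (FaxPath-extend path i∈K) j∈J ,
    update-child (env₁ env b ξ K) (ξ · i) J Π _ j j∈J
  copycatEnv-step {env} {Γ} {ξ} {ξ'} {g} {K} {i} b J cc Γ# p m path i∈K {ζ} ζ∈ | inj₂ old
    with cc (─-⊆ p old) | ─-disjoint Γ# p old
  ... | ζ' , g' , m' , path' , e | _ , ξ⋢ζ =
    ζ' , g' , m' , path' ,
    trans (update-outside (env₁ env b ξ K) (ξ · i) J Π _ ζ (λ ξi⊑ζ → ξ⋢ζ (⊑-trans (⊑-child ξ i) ξi⊑ζ)))
      (trans (update-outside env ξ K D _ ζ ξ⋢ζ) e)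

  cut-answered : ∀ {env b ξ K ξ' g} → X (b ∷ʳ pos ξ K) → env ξ ≡ just (Π , Q g) →
    Mirror ξ ξ' → FaxPath τ α g ξ ξ' → NoVisibleCut env →
    Eval env D (P b) (hvis ξ' K Π (Q g ∷ʳ neg ξ K) (env₁ env b ξ K))
  cut-answered {K = K} {ξ' = ξ'} x e m path nvc =
    evCut (X→D _ x) e
      (evVis (copycat-answered path) (no-visible-cut-update K D _ (mirror-σ m) nvc ξ' (mirror-α m)))

  answer-copied : ∀ {env b g ξ K ξ' i J h} → FaxPath τ α g ξ ξ' → i ∈R K →
    Eval (env₂ env b g ξ K ξ' i J) D (P (b ∷ʳ pos ξ K ∷ʳ neg (ξ · i) J)) h →
    Eval (env₁ env b ξ K) Π (Q (g ∷ʳ neg ξ K ∷ʳ pos ξ' K ∷ʳ neg (ξ' · i) J)) h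
  answer-copied {env} {b} {g} {ξ} {K} {ξ'} {i} path i∈K =
    evCut (copycat-answered (FaxPath-extend path i∈K)) (update-child env ξ K D _ i i∈K)

  forward : ∀ {envE E e} env b Γ k → ChronP Γ k → X (b ++ k) → CopycatEnv env Γ →
    PairwiseDisjoint Γ → NoVisibleCut env →
    (∀ {h} → Eval env D (P b) h → Eval envE E e h) → Out envE E e (map relocate k)
  forward env b Γ _ c† x cc Γ# nvc ev = o† (ev (ev† (X→D _ x)))
  forward env b Γ (pos ξ K ∷ []) (cend p) x cc Γ# nvc ev with cc p
  ... | ξ' , g , m , path , e rewrite mirror-relocates m =
    oVis (ev (cut-answered x e m path nvc))
  forward env b Γ (pos ξ K ∷ neg _ J ∷ k) (cstep {i = i} p i∈K c) x cc Γ# nvc ev with cc p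
  ... | ξ' , g , m , path , e rewrite mirror-relocates m | mirror-relocates (child i m) =
    oStep (ev (cut-answered (X-arborescent b (pos ξ K) _ tt x) e m path nvc)) i∈K
      (forward (env₂ env b g ξ K ξ' i J) (b ∷ʳ pos ξ K ∷ʳ neg (ξ · i) J) _ k c
        (subst X (sym (∷ʳ-∷ʳ-++ b _ _ k)) x)
        (copycatEnv-step b J cc Γ# p m path i∈K) (step-pairwiseDisjoint i J Γ# p)
        (no-visible-cut-update J Π _ (⊑-trans (mirror-σ m) (⊑-child ξ i))
          (no-visible-cut-update K D _ (mirror-σ m) nvc))
        (answer-copied path i∈K))

  Invariant : Env → Chronicle → Set₁
  Invariant env b = ∀ k → ChronP [ τ ] (b ++ k) →
    Σ (List Locus) λ Γ → ChronP Γ k × PairwiseDisjoint Γ × CopycatEnv env Γ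

  invariant-step : ∀ {env b g ξ K ξ' i J} → Invariant env b → Mirror ξ ξ' → FaxPath τ α g ξ ξ' →
    i ∈R K → Invariant (env₂ env b g ξ K ξ' i J) (b ∷ʳ pos ξ K ∷ʳ neg (ξ · i) J)
  invariant-step {env} {b} {g} {ξ} {K} {ξ'} {i} {J} inv m path i∈K k c
    with inv (pos ξ K ∷ neg (ξ · i) J ∷ k) (subst (ChronP [ τ ]) (∷ʳ-∷ʳ-++ b _ _ k) c)
  ... | Γ , c' , Γ# , cc with chronP-step c'
  ...   | p , _ , _ , ξi≡ , c'' with ∷ʳ-injectiveʳ ξ ξ ξi≡
  ...     | refl = _ , c'' , step-pairwiseDisjoint i J Γ# p , copycatEnv-step b J cc Γ# p m path i∈K

  data HeadResult (env : Env) (b : Chronicle) : Hnf → Set₁ where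
    daimon  : X (b ∷ʳ dai) → HeadResult env b hdai
    visible : ∀ {ξ K ξ' g} → X (b ∷ʳ pos ξ K) → Mirror ξ ξ' → FaxPath τ α g ξ ξ' →
              HeadResult env b (hvis ξ' K Π (Q g ∷ʳ neg ξ K) (env₁ env b ξ K))

  dai≢pos : ∀ {ξ K} → dai ≢ pos ξ K
  dai≢pos ()

  eval-answer : ∀ {env b ξ K ξ' g h} → X (b ∷ʳ pos ξ K) → Mirror ξ ξ' → FaxPath τ α g ξ ξ' →
    NoVisibleCut env → Eval (env₁ env b ξ K) Π (Q g ∷ʳ neg ξ K) h → HeadResult env b h
  eval-answer x m path nvc (ev† d) = ⊥-elim (dai≢pos (copycat-answer path d))
  eval-answer x m path nvc (evVis d e) with copycat-answer path d
  ... | refl = visible x m path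
  eval-answer {K = K} {ξ'} x m path nvc (evCut d e _) with copycat-answer path d
  ... | refl = ⊥-elim (nothing≢just (trans (sym (no-visible-cut-update K D _ (mirror-σ m) nvc ξ' (mirror-α m))) e))

  eval-head : ∀ {env b h} → Invariant env b → NoVisibleCut env → Eval env D (P b) h → HeadResult env b h
  eval-head inv nvc (ev† d) = daimon (D→X _ d)
  eval-head inv nvc (evVis {ξ} {K} d e) with inv [ pos ξ K ] (X-chron _ (D→X _ d))
  ... | _ , c , _ , cc with cc (chronP-end c)
  ...   | _ , _ , _ , _ , e' = ⊥-elim (nothing≢just (trans (sym e) e'))
  eval-head inv nvc (evCut {ξ} {K} d e ev) with inv [ pos ξ K ] (X-chron _ (D→X _ d))
  ... | _ , c , _ , cc with cc (chronP-end c)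
  ...   | _ , _ , m , path , e' with trans (sym e) e'
  ...     | refl = eval-answer (D→X _ d) m path nvc ev

  answer-copied⁻¹ : ∀ {env b g ξ K ξ' i J h} → FaxPath τ α g ξ ξ' → i ∈R K →
    Eval (env₁ env b ξ K) Π (Q (g ∷ʳ neg ξ K ∷ʳ pos ξ' K ∷ʳ neg (ξ' · i) J)) h →
    Eval (env₂ env b g ξ K ξ' i J) D (P (b ∷ʳ pos ξ K ∷ʳ neg (ξ · i) J)) h
  answer-copied⁻¹ path i∈K (ev† d) = ⊥-elim (dai≢pos (copycat-answer (FaxPath-extend path i∈K) d))
  answer-copied⁻¹ {env} {ξ = ξ} {K} {i = i} path i∈K (evVis d e)
    with copycat-answer (FaxPath-extend path i∈K) d
  ... | refl = ⊥-elim (nothing≢just (trans (sym e) (update-child env ξ K D _ i i∈K)))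
  answer-copied⁻¹ {env} {ξ = ξ} {K} {i = i} path i∈K (evCut d e ev)
    with copycat-answer (FaxPath-extend path i∈K) d
  ... | refl with trans (sym e) (update-child env ξ K D _ i i∈K)
  ...   | refl = ev

  backward : ∀ {envE E e k} env b → Invariant env b → NoVisibleCut env →
    (∀ {h} → Eval envE E e h → Eval env D (P b) h) → Out envE E e k →
    Σ Chronicle λ a → X (b ++ a) × k ≡ map relocate a
  backward env b inv nvc ev (o† e) with eval-head inv nvc (ev e)
  ... | daimon x = [ dai ] , x , refl
  backward env b inv nvc ev (oVis e) with eval-head inv nvc (ev e)
  ... | visible {ξ} {K} x m path = [ pos ξ K ] , x , cong (λ ζ → [ pos ζ K ]) (sym (mirror-relocates m))
  backward env b inv nvc ev (oStep {i = i} {J} e i∈K o) with eval-head inv nvc (ev e)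
  ... | visible {ξ} {K} {ξ'} {g} x m path
    with backward (env₂ env b g ξ K ξ' i J) (b ∷ʳ pos ξ K ∷ʳ neg (ξ · i) J)
           (invariant-step inv m path i∈K)
           (no-visible-cut-update J Π _ (⊑-trans (mirror-σ m) (⊑-child ξ i))
             (no-visible-cut-update K D _ (mirror-σ m) nvc))
           (answer-copied⁻¹ path i∈K) o
  ...   | a , x' , refl =
    pos ξ K ∷ neg (ξ · i) J ∷ a , subst X (∷ʳ-∷ʳ-++ b _ _ a) x' ,
    cong₂ (λ ζ η → pos ζ K ∷ neg η J ∷ map relocate a)
      (sym (mirror-relocates m)) (sym (mirror-relocates (child i m)))

  -- The opening: D plays (+,σ,{1,2}) into Π, which answers (+,σ.n,r),
  -- and the head returns to D at P [], with X's base ⊢ τ cut against the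
  -- copycat.
  projection-opening : ∀ a → Π (neg σ ram12 ∷ a ∷ []) → a ≡ pos (σ · n) r
  projection-opening a (inj₁ e) = ∷-injectiveˡ (∷-injectiveʳ e)
  projection-opening a (inj₂ (c , f , e)) = ⊥-elim (subst (Fax τ α) (sym (∷-injectiveʳ (∷-injectiveʳ e))) f)

  env-opened : Env
  env-opened = update (cutEnv σ Π) σ ram12 D [ pos σ ram12 ]

  env-start : Env
  env-start = update env-opened (σ · n) r Π (Q [])

  opening : ∀ {h} → Eval env-start D (P []) h → Eval (cutEnv σ Π) D [] h
  opening ev = evCut D-opens (cutEnv-self σ Π)
    (evCut (inj₁ refl) (update-child (cutEnv σ Π) σ ram12 D _ n n∈12) ev)

  opening⁻¹ : ∀ {h} → Eval (cutEnv σ Π) D [] h → Eval env-start D (P []) h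
  opening⁻¹ (ev† d) = ⊥-elim (dai≢pos (D-opening _ d))
  opening⁻¹ (evVis d e) with D-opening _ d
  ... | refl = ⊥-elim (nothing≢just (trans (sym e) (cutEnv-self σ Π)))
  opening⁻¹ (evCut d e ev) with D-opening _ d
  ... | refl with trans (sym e) (cutEnv-self σ Π)
  ...   | refl = answer ev
    where
    answer : ∀ {h} → Eval env-opened Π [ neg σ ram12 ] h → Eval env-start D (P []) h
    answer (ev† d) = ⊥-elim (dai≢pos (projection-opening _ d))
    answer (evVis d e) with projection-opening _ d
    ... | refl = ⊥-elim (nothing≢just (trans (sym e) (update-child (cutEnv σ Π) σ ram12 D _ n n∈12)))
    answer (evCut d e ev) with projection-opening _ d
    ... | refl with trans (sym e) (update-child (cutEnv σ Π) σ ram12 D _ n n∈12)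
    ...   | refl = ev

  start-copycat : CopycatEnv env-start [ τ ]
  start-copycat (here refl) = α , [] , base , waiting , update-child env-opened (σ · n) r Π (Q []) n n∈r

  start-noVisibleCut : NoVisibleCut env-start
  start-noVisibleCut =
    no-visible-cut-update r Π _ (⊑-child σ n)
      (no-visible-cut-update ram12 D _ (⊑-refl σ)
        (λ l α⊑l → cutEnv-outside σ Π l (λ σ⊑l → below-σ-not-α (⊑-refl σ) α⊑l σ⊑l)))

  start-invariant : Invariant env-start []
  start-invariant k c = [ τ ] , c , [] ∷ [] , start-copycat

  normalForm : NormalForm σ Π D ≐ Reloc τ α X
  normalForm k =
    (λ o → backward env-start [] start-invariant start-noVisibleCut opening⁻¹ o) ,
    (λ { (c , x , refl) →
      forward env-start [] [ τ ] c (X-chron c x) x start-copycat ([] ∷ []) start-noVisibleCut opening })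

ram1≢ram2 : ram1 ≢ ram2
ram1≢ram2 ()

neg-ram : ∀ {ξ ζ I J} → neg ξ I ≡ neg ζ J → I ≡ J
neg-ram refl = refl

pair-opening : ∀ σ A B a → Dpair σ A B [ a ] → a ≡ pos σ ram12
pair-opening σ A B a (inj₁ e) = ∷-injectiveˡ e
pair-opening σ A B a (inj₂ (inj₁ (_ , _ , ())))
pair-opening σ A B a (inj₂ (inj₂ (_ , _ , ())))

pair-first : ∀ σ A B c → Dpair σ A B (pos σ ram12 ∷ neg (σ · 1) ram1 ∷ c) → A c
pair-first σ A B c (inj₁ ())
pair-first σ A B c (inj₂ (inj₁ (_ , a , e))) = subst A (sym (∷-injectiveʳ (∷-injectiveʳ e))) a
pair-first σ A B c (inj₂ (inj₂ (_ , _ , e))) = ⊥-elim (ram1≢ram2 (neg-ram (∷-injectiveˡ (∷-injectiveʳ e))))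

pair-second : ∀ σ A B c → Dpair σ A B (pos σ ram12 ∷ neg (σ · 2) ram2 ∷ c) → B c
pair-second σ A B c (inj₁ ())
pair-second σ A B c (inj₂ (inj₁ (_ , _ , e))) = ⊥-elim (ram1≢ram2 (sym (neg-ram (∷-injectiveˡ (∷-injectiveʳ e)))))
pair-second σ A B c (inj₂ (inj₂ (_ , b , e))) = subst B (sym (∷-injectiveʳ (∷-injectiveʳ e))) b

mainTheorem5 : (σ α : Locus) → Disjoint σ α →
    (𝔸 : Design → Set) → (∀ A → 𝔸 A → DesignOn (σ · 1 · 1) A) →
    (𝔹 : Design → Design → Set) → (∀ A B → 𝔸 A → 𝔹 A B → DesignOn (σ · 2 · 2) B) →
    ∀ A B → 𝔸 A → 𝔹 A B →
    (NormalForm σ (π₁ σ α) (Dpair σ A B) ≐ Reloc (σ · 1 · 1) α A)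
    × (NormalForm σ (π₂ σ α) (Dpair σ A B) ≐ Reloc (σ · 2 · 2) α B)
mainTheorem5 σ α σ#α 𝔸 𝔸-designs 𝔹 𝔹-designs A B A∈𝔸 B∈𝔹 = first , second
  where
  A-design : DesignOn (σ · 1 · 1) A
  A-design = 𝔸-designs A A∈𝔸

  B-design : DesignOn (σ · 2 · 2) B
  B-design = 𝔹-designs A B A∈𝔸 B∈𝔹

  first : NormalForm σ (π₁ σ α) (Dpair σ A B) ≐ Reloc (σ · 1 · 1) α A
  first = ProjectionNormalForm.normalForm σ α σ#α 1 ram1 (here refl) (here refl) (Dpair σ A B) A
    (pair-opening σ A B) (inj₁ refl) (pair-first σ A B) (λ c a → inj₂ (inj₁ (c , a , refl)))
    (proj₁ A-design) (proj₁ (proj₂ A-design))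

  second : NormalForm σ (π₂ σ α) (Dpair σ A B) ≐ Reloc (σ · 2 · 2) α B
  second = ProjectionNormalForm.normalForm σ α σ#α 2 ram2 (here refl) (there (here refl)) (Dpair σ A B) B
    (pair-opening σ A B) (inj₁ refl) (pair-second σ A B) (λ c b → inj₂ (inj₂ (c , b , refl)))
    (proj₁ B-design) (proj₁ (proj₂ B-design))
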